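{- If $m$ and $y$ are integers with $m\geq 4$ and $1\leq y\leq\lfloor\frac{m-2}{2}\rfloor$, then \[\frac{L_{m-2}+L_{m-4y}}{5F_{m-1}}>\sqrt5-2.\] Furthermore, if $m\geq 4$ and $m\notin\{5,7\}$, then \[\frac{L_{m-2}+L_{m-4}}{5F_{m-1}}\geq\frac{8}{21}.\]
   Context: $F_j$ and $L_j$ are the Fibonacci and Lucas numbers, defined for all integers $j$ by $F_1=F_2=1$, $L_1=1$, $L_2=3$, and $F_{j+2}=F_{j+1}+F_j$, $L_{j+2}=L_{j+1}+L_j$. -}

module Defs where

open import Data.Nat using (ℕ; zero; suc)
open import Data.Integer using (ℤ; +_; -[1+_]; _+_; _-_)
open import Data.Product using (_×_; _,_; proj₁; proj₂)
open import Data.Rational using (ℚ; 0ℚ; _÷_; _<_; _≤_; _*_; ≢-nonZero)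
open import Data.Rational.Properties using (_≟_)
import Data.Rational as ℚ
open import Relation.Nullary using (yes; no)

fromℤ : ℤ → ℚ
fromℤ z = z ℚ./ 1


-- Sequences satisfying X_{j+2} = X_{j+1} + X_j for all integers j,
-- determined by the initial values (X_0 , X_1).
-- forward n = (X_n , X_{n+1})
forward : ℤ × ℤ → ℕ → ℤ × ℤ
forward init zero = init
forward init (suc n) with forward init n
... | (a , b) = (b , a + b)

-- backward k = (X_{-k} , X_{-k+1}), using X_j = X_{j+2} - X_{j+1}
backward : ℤ × ℤ → ℕ → ℤ × ℤ
backward init zero = init
backward init (suc k) with backward init k
... | (a , b) = (b - a , a)

seq : ℤ × ℤ → ℤ → ℤ
seq init (+ n)      = proj₁ (forward init n)
seq init -[1+ k ]   = proj₁ (backward init (suc k))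

F : ℤ → ℤ
F = seq (+ 0 , + 1)

L : ℤ → ℤ
L = seq (+ 2 , + 1)

-- Division of integers as a rational number (total; value 0 when the
-- denominator is 0, a case that never arises in the statement).
_÷ℤ_ : ℤ → ℤ → ℚ
a ÷ℤ b with fromℤ b ≟ 0ℚ
... | yes _  = 0ℚ
... | no b≢0 = _÷_ (fromℤ a) (fromℤ b) {{≢-nonZero b≢0}}

-- "q > √5 - 2", i.e. q + 2 > √5, for a rational q: since √5 is the unique
-- positive real whose square is 5, this holds iff q + 2 > 0 and (q + 2)² > 5.
_>√5-2 : ℚ → Set
q >√5-2 = (0ℚ < q ℚ.+ fromℤ (+ 2)) × (fromℤ (+ 5) < (q ℚ.+ fromℤ (+ 2)) * (q ℚ.+ fromℤ (+ 2)))

-- Put n = m − 2 and j = m − 4y.  As L₋ₖ = (−1)ᵏ Lₖ, we have L_j ≥ 0 unless j is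
-- negative and odd.  If L_j ≥ 0, the ratio is at least L_n / (5 F_{n+1}) ≥ 4/15,
-- because 3 L_{k+3} = 4 F_{k+4} + F_k, and 4/15 > √5 − 2.  Otherwise n is odd and
-- 1 ≤ −j ≤ n − 4, so L_n + L_j ≥ L_n − L_{n−4} = 5 F_{n−2}; the ratio is then at
-- least F_{n−2} / F_{n+1}, which exceeds √5 − 2 because Cassini's identity at the
-- odd index n − 2 gives (F_{n−2} + 2 F_{n+1})² = 5 F_{n+1}² + 4.
-- For the second part L_n + L_{n−2} = 5 F_{n−1}, so the ratio is F_{n−1} / F_{n+1};
-- 21 F_{k+6} = 8 F_{k+8} + F_k settles n ≥ 7 and the remaining n are checked
-- directly.  All identities between F and L follow from uniqueness of solutions of
-- the Fibonacci recurrence with given initial values.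

module Submission where

open import Defs
open import Data.Integer using (ℤ; +_; _+_; _-_; _*_; _≤_; _/ℕ_)
open import Data.Product using (_×_; _,_; proj₁; proj₂)
import Data.Rational as ℚ

open import Data.Nat as ℕ using (ℕ; zero; suc; s≤s; z≤n)
open import Data.Integer as ℤ using (-[1+_]; -_; _^_; -1ℤ; _<_; +≤+; +<+)
import Data.Integer.Properties as ℤP
import Data.Nat.Properties as ℕP
import Data.Nat.DivMod as DM
open import Data.Integer.Tactic.RingSolver using (solve-∀)
open import Data.Nat.Tactic.RingSolver renaming (solve-∀ to ℕ-solve-∀) using ()
open import Data.Rational using (ℚ; mkℚ; 0ℚ; toℚᵘ; ≢-nonZero; _÷_; nonNegative)
import Data.Rational.Properties as ℚP
open import Data.Rational.Unnormalised as ℚᵘ using (mkℚᵘ; *≡*; *<*; *≤*)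
import Data.Rational.Unnormalised.Properties as ℚᵘP
open import Relation.Nullary using (yes; no; contradiction)
open import Function using (_∘_)
open import Relation.Binary.PropositionalEquality
  using (_≡_; _≢_; refl; sym; trans; cong; cong₂; subst; subst₂; module ≡-Reasoning)

toℚᵘ-fromℤ : ∀ a → toℚᵘ (fromℤ a) ℚᵘ.≃ mkℚᵘ a 0
toℚᵘ-fromℤ a = ℚP.toℚᵘ-fromℚᵘ (mkℚᵘ a 0)

÷ℤ-≃ : ∀ a c → toℚᵘ (a ÷ℤ (+ suc c)) ℚᵘ.≃ mkℚᵘ a c
÷ℤ-≃ a c with fromℤ (+ suc c) ℚP.≟ 0ℚ
... | yes b≡0 = contradiction
  (ℚᵘP.≃-trans (ℚᵘP.≃-sym (toℚᵘ-fromℤ (+ suc c))) (ℚP.toℚᵘ-cong b≡0)) λ { (*≡* ()) }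
... | no b≢0 = cancel q (begin
  toℚᵘ q ℚᵘ.* mkℚᵘ (+ suc c) 0 ≈⟨ ℚᵘP.*-congˡ {toℚᵘ q} (toℚᵘ-fromℤ (+ suc c)) ⟨
  toℚᵘ q ℚᵘ.* toℚᵘ b            ≈⟨ ℚP.toℚᵘ-homo-* q b ⟨
  toℚᵘ (q ℚ.* b)                ≡⟨ cong toℚᵘ q*b≡a ⟩
  toℚᵘ (fromℤ a)                ≈⟨ toℚᵘ-fromℤ a ⟩
  mkℚᵘ a 0                      ∎)
  where
  open ℚᵘP.≃-Reasoning
  instance _ = ≢-nonZero b≢0
  b = fromℤ (+ suc c)
  q = fromℤ a ÷ b
  q*b≡a : q ℚ.* b ≡ fromℤ a
  q*b≡a = trans (ℚP.*-assoc (fromℤ a) (ℚ.1/ b) b)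
            (trans (cong (fromℤ a ℚ.*_) (ℚP.*-inverseˡ b)) (ℚP.*-identityʳ (fromℤ a)))
  cancel : ∀ q → toℚᵘ q ℚᵘ.* mkℚᵘ (+ suc c) 0 ℚᵘ.≃ mkℚᵘ a 0 → toℚᵘ q ℚᵘ.≃ mkℚᵘ a c
  cancel (mkℚ n d _) (*≡* e) =
    *≡* (trans (sym (ℤP.*-identityʳ _)) (trans e (cong (λ x → a * + suc x) (ℕP.*-identityʳ d))))

÷ℤ-mono-≤ : ∀ {a b c d} → + 0 < b → + 0 < d → a * d ≤ c * b → (a ÷ℤ b) ℚ.≤ (c ÷ℤ d)
÷ℤ-mono-≤ {a} {+ suc b} {c} {+ suc d} (+<+ _) (+<+ _) ad≤cb = ℚP.toℚᵘ-cancel-≤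
  (ℚᵘP.≤-respˡ-≃ (ℚᵘP.≃-sym (÷ℤ-≃ a b))
    (ℚᵘP.≤-respʳ-≃ (ℚᵘP.≃-sym (÷ℤ-≃ c d)) (*≤* ad≤cb)))

÷ℤ->√5-2 : ∀ a b → + 0 < b → + 0 < a + + 2 * b →
           + 5 * (b * b) < (a + + 2 * b) * (a + + 2 * b) → (a ÷ℤ b) >√5-2
÷ℤ->√5-2 a (+ suc c) (+<+ _) 0<s 5b²<s² = 0<q+2 , 5<[q+2]²
  where
  b = + suc c
  s = a + + 2 * b
  q+2 = (a ÷ℤ b) ℚ.+ fromℤ (+ 2)
  q+2≃s/b : toℚᵘ q+2 ℚᵘ.≃ mkℚᵘ s c
  q+2≃s/b = begin
    toℚᵘ q+2                              ≈⟨ ℚP.toℚᵘ-homo-+ (a ÷ℤ b) (fromℤ (+ 2)) ⟩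
    toℚᵘ (a ÷ℤ b) ℚᵘ.+ toℚᵘ (fromℤ (+ 2)) ≈⟨ ℚᵘP.+-cong (÷ℤ-≃ a c) (toℚᵘ-fromℤ (+ 2)) ⟩
    mkℚᵘ a c ℚᵘ.+ mkℚᵘ (+ 2) 0            ≈⟨ *≡* (trans (cong (λ x → (x + + 2 * b) * b) (ℤP.*-identityʳ a))
                                                           (cong (λ x → s * + suc x) (sym (ℕP.*-identityʳ c)))) ⟩
    mkℚᵘ s c                              ∎
    where open ℚᵘP.≃-Reasoning
  0<q+2 : 0ℚ ℚ.< q+2
  0<q+2 = ℚP.toℚᵘ-cancel-< (ℚᵘP.<-respʳ-≃ (ℚᵘP.≃-sym q+2≃s/b)
            (*<* (subst (+ 0 <_) (sym (ℤP.*-identityʳ s)) 0<s)))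
  5<[q+2]² : fromℤ (+ 5) ℚ.< q+2 ℚ.* q+2
  5<[q+2]² = ℚP.toℚᵘ-cancel-< (ℚᵘP.<-respʳ-≃
               (ℚᵘP.≃-sym (ℚᵘP.≃-trans (ℚP.toℚᵘ-homo-* q+2 q+2) (ℚᵘP.*-cong q+2≃s/b q+2≃s/b)))
               (*<* (subst (+ 5 * (b * b) <_) (sym (ℤP.*-identityʳ (s * s))) 5b²<s²)))

>√5-2-mono-≤ : ∀ {p q} → p ℚ.≤ q → p >√5-2 → q >√5-2
>√5-2-mono-≤ {p} {q} p≤q (0<p+2 , 5<[p+2]²) = 0<q+2 , ℚP.<-≤-trans 5<[p+2]² [p+2]²≤[q+2]²
  where
  p+2 = p ℚ.+ fromℤ (+ 2)
  q+2 = q ℚ.+ fromℤ (+ 2)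
  p+2≤q+2 : p+2 ℚ.≤ q+2
  p+2≤q+2 = ℚP.+-monoˡ-≤ (fromℤ (+ 2)) p≤q
  0<q+2 : 0ℚ ℚ.< q+2
  0<q+2 = ℚP.<-≤-trans 0<p+2 p+2≤q+2
  instance
    _ = nonNegative (ℚP.<⇒≤ 0<p+2)
    _ = nonNegative (ℚP.<⇒≤ 0<q+2)
  [p+2]²≤[q+2]² : p+2 ℚ.* p+2 ℚ.≤ q+2 ℚ.* q+2
  [p+2]²≤[q+2]² = ℚP.≤-trans (ℚP.*-monoˡ-≤-nonNeg p+2 p+2≤q+2) (ℚP.*-monoʳ-≤-nonNeg q+2 p+2≤q+2)

record FibonacciRecurrence (g : ℕ → ℤ) : Set where
  constructor recurrence
  field step : ∀ n → g (2 ℕ.+ n) ≡ g n + g (1 ℕ.+ n)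

open FibonacciRecurrence

F-recurrence : FibonacciRecurrence (λ n → F (+ n))
F-recurrence = recurrence λ n → refl

L-recurrence : FibonacciRecurrence (λ n → L (+ n))
L-recurrence = recurrence λ n → refl

recurrence-+ : ∀ {g h} → FibonacciRecurrence g → FibonacciRecurrence h →
               FibonacciRecurrence (λ n → g n + h n)
recurrence-+ {g} {h} rg rh = recurrence λ n → trans (cong₂ _+_ (step rg n) (step rh n))
  (interchange (g n) (g (1 ℕ.+ n)) (h n) (h (1 ℕ.+ n)))
  where
  interchange : ∀ w x y z → (w + x) + (y + z) ≡ (w + y) + (x + z)
  interchange = solve-∀

recurrence-*ˡ : ∀ k {g} → FibonacciRecurrence g → FibonacciRecurrence (λ n → k * g n)
recurrence-*ˡ k {g} rg = recurrence λ n → trans (cong (k *_) (step rg n)) (ℤP.*-distribˡ-+ k (g n) (g (1 ℕ.+ n)))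

recurrence-shift : ∀ k {g} → FibonacciRecurrence g → FibonacciRecurrence (λ n → g (k ℕ.+ n))
recurrence-shift k {g} rg = recurrence λ n →
  trans (cong g (k+2+n≡2+k+n n)) (trans (step rg (k ℕ.+ n)) (cong (λ i → g (k ℕ.+ n) + g i) (sym (ℕP.+-suc k n))))
  where
  k+2+n≡2+k+n : ∀ n → k ℕ.+ (2 ℕ.+ n) ≡ 2 ℕ.+ (k ℕ.+ n)
  k+2+n≡2+k+n n = trans (ℕP.+-suc k (suc n)) (cong suc (ℕP.+-suc k n))

recurrence-unique : ∀ {g h} → FibonacciRecurrence g → FibonacciRecurrence h →
                    g 0 ≡ h 0 → g 1 ≡ h 1 → ∀ n → g n ≡ h n
recurrence-unique {g} {h} rg rh g0≡h0 g1≡h1 = go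
  where
  go : ∀ n → g n ≡ h n
  go zero          = g0≡h0
  go (suc zero)    = g1≡h1
  go (suc (suc n)) = trans (step rg n) (trans (cong₂ _+_ (go n) (go (suc n))) (sym (step rh n)))

recurrence-nonNeg : ∀ {g} → FibonacciRecurrence g → + 0 ≤ g 0 → + 0 ≤ g 1 → ∀ n → + 0 ≤ g n
recurrence-nonNeg {g} rg 0≤g0 0≤g1 = go
  where
  go : ∀ n → + 0 ≤ g n
  go zero          = 0≤g0
  go (suc zero)    = 0≤g1
  go (suc (suc n)) = subst (+ 0 ≤_) (sym (step rg n)) (ℤP.+-mono-≤ (go n) (go (suc n)))

recurrence-mono : ∀ {g} → FibonacciRecurrence g → (∀ n → + 0 ≤ g n) →
                  ∀ {i j} → i ℕ.≤′ j → g (suc i) ≤ g (suc j)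
recurrence-mono {g} rg 0≤g = go
  where
  go : ∀ {i j} → i ℕ.≤′ j → g (suc i) ≤ g (suc j)
  go ℕ.≤′-refl              = ℤP.≤-refl
  go (ℕ.≤′-step {n} i≤′n) = ℤP.≤-trans (go i≤′n)
    (subst (g (suc n) ≤_) (sym (step rg n)) (ℤP.i≤j⇒i≤k+j (g n) {{ℤ.nonNegative (0≤g n)}} ℤP.≤-refl))

L[2+n]+L[n]≡5F[1+n] : ∀ n → L (+ (2 ℕ.+ n)) + L (+ n) ≡ + 5 * F (+ (1 ℕ.+ n))
L[2+n]+L[n]≡5F[1+n] = recurrence-unique
  (recurrence-+ (recurrence-shift 2 L-recurrence) L-recurrence)
  (recurrence-*ˡ (+ 5) (recurrence-shift 1 F-recurrence)) refl refl

L[4+n]≡L[n]+5F[2+n] : ∀ n → L (+ (4 ℕ.+ n)) ≡ L (+ n) + + 5 * F (+ (2 ℕ.+ n))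
L[4+n]≡L[n]+5F[2+n] = recurrence-unique
  (recurrence-shift 4 L-recurrence)
  (recurrence-+ L-recurrence (recurrence-*ˡ (+ 5) (recurrence-shift 2 F-recurrence))) refl refl

3L[3+n]≡4F[4+n]+F[n] : ∀ n → + 3 * L (+ (3 ℕ.+ n)) ≡ + 4 * F (+ (4 ℕ.+ n)) + F (+ n)
3L[3+n]≡4F[4+n]+F[n] = recurrence-unique
  (recurrence-*ˡ (+ 3) (recurrence-shift 3 L-recurrence))
  (recurrence-+ (recurrence-*ˡ (+ 4) (recurrence-shift 4 F-recurrence)) F-recurrence) refl refl

21F[6+n]≡8F[8+n]+F[n] : ∀ n → + 21 * F (+ (6 ℕ.+ n)) ≡ + 8 * F (+ (8 ℕ.+ n)) + F (+ n)
21F[6+n]≡8F[8+n]+F[n] = recurrence-unique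
  (recurrence-*ˡ (+ 21) (recurrence-shift 6 F-recurrence))
  (recurrence-+ (recurrence-*ˡ (+ 8) (recurrence-shift 8 F-recurrence)) F-recurrence) refl refl

F-nonNeg : ∀ n → + 0 ≤ F (+ n)
F-nonNeg = recurrence-nonNeg F-recurrence (+≤+ z≤n) (+≤+ z≤n)

L-nonNeg : ∀ n → + 0 ≤ L (+ n)
L-nonNeg = recurrence-nonNeg L-recurrence (+≤+ z≤n) (+≤+ z≤n)

F-pos : ∀ n → + 0 < F (+ suc n)
F-pos n = ℤP.<-≤-trans (+<+ (s≤s z≤n)) (recurrence-mono F-recurrence F-nonNeg (ℕP.≤⇒≤′ (z≤n {n})))

L-mono : ∀ {i j} → i ℕ.≤ j → L (+ suc i) ≤ L (+ suc j)
L-mono i≤j = recurrence-mono L-recurrence L-nonNeg (ℕP.≤⇒≤′ i≤j)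

cassini : ∀ n → F (+ (1 ℕ.+ n)) * F (+ (1 ℕ.+ n)) - F (+ n) * F (+ (2 ℕ.+ n)) ≡ -1ℤ ^ n
cassini zero    = refl
cassini (suc n) = trans (flip-sign (F (+ n)) (F (+ suc n))) (trans (cong -_ (cassini n)) (sym (ℤP.-1*i≡-i _)))
  where
  flip-sign : ∀ x y → (x + y) * (x + y) - y * (y + (x + y)) ≡ - (y * y - x * (x + y))
  flip-sign = solve-∀

-1^[n+n]≡1 : ∀ n → -1ℤ ^ (n ℕ.+ n) ≡ + 1
-1^[n+n]≡1 zero    = refl
-1^[n+n]≡1 (suc n) = begin
  -1ℤ ^ (suc n ℕ.+ suc n)       ≡⟨ cong (λ k → -1ℤ ^ suc k) (ℕP.+-suc n n) ⟩
  -1ℤ * (-1ℤ * -1ℤ ^ (n ℕ.+ n)) ≡⟨ cong (λ x → -1ℤ * (-1ℤ * x)) (-1^[n+n]≡1 n) ⟩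
  + 1                           ∎
  where open ≡-Reasoning

backward-L : ∀ k → backward (+ 2 , + 1) (suc k) ≡ (-1ℤ ^ suc k * L (+ suc k) , -1ℤ ^ k * L (+ k))
backward-L zero    = refl
backward-L (suc k) = trans (cong (λ p → (proj₂ p - proj₁ p , proj₁ p)) (backward-L k))
  (cong (_, -1ℤ ^ suc k * L (+ suc k)) (alternate (-1ℤ ^ k) (L (+ k)) (L (+ suc k))))
  where
  alternate : ∀ s x y → s * x - (-1ℤ * s) * y ≡ -1ℤ * (-1ℤ * s) * (x + y)
  alternate = solve-∀

L[-k]≡[-1]^k*L[k] : ∀ k → L (- + k) ≡ -1ℤ ^ k * L (+ k)
L[-k]≡[-1]^k*L[k] zero    = refl
L[-k]≡[-1]^k*L[k] (suc k) = cong proj₁ (backward-L k)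

L[i+i]≥0 : ∀ i → + 0 ≤ L (i + i)
L[i+i]≥0 (+ n)     = L-nonNeg (n ℕ.+ n)
L[i+i]≥0 -[1+ n ]  = subst (+ 0 ≤_) (sym L[-2-n-n]≡L[2+n+n]) (L-nonNeg (2 ℕ.+ (n ℕ.+ n)))
  where
  L[-2-n-n]≡L[2+n+n] : L (- + (2 ℕ.+ (n ℕ.+ n))) ≡ L (+ (2 ℕ.+ (n ℕ.+ n)))
  L[-2-n-n]≡L[2+n+n] = trans (L[-k]≡[-1]^k*L[k] (2 ℕ.+ (n ℕ.+ n)))
    (trans (cong (λ x → -1ℤ * (-1ℤ * x) * L (+ (2 ℕ.+ (n ℕ.+ n)))) (-1^[n+n]≡1 n)) (ℤP.*-identityˡ _))

L[-1-s-s]≡-L[1+s+s] : ∀ s → L -[1+ s ℕ.+ s ] ≡ - L (+ suc (s ℕ.+ s))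
L[-1-s-s]≡-L[1+s+s] s = trans (L[-k]≡[-1]^k*L[k] (suc (s ℕ.+ s)))
  (trans (cong (λ x → -1ℤ * x * L (+ suc (s ℕ.+ s))) (-1^[n+n]≡1 s)) (ℤP.-1*i≡-i _))

lucasRatio : ℕ → ℤ → ℚ
lucasRatio n j = (L (+ n) + L j) ÷ℤ (+ 5 * F (+ suc n))

5F-pos : ∀ n → + 0 < + 5 * F (+ suc n)
5F-pos n = ℤP.*-monoˡ-<-pos (+ 5) (F-pos n)

4F[3+n]≤3L[2+n] : ∀ n → + 4 * F (+ (3 ℕ.+ n)) ≤ + 3 * L (+ (2 ℕ.+ n))
4F[3+n]≤3L[2+n] zero    = +≤+ (ℕP.m≤m+n 8 1)
4F[3+n]≤3L[2+n] (suc n) = subst (+ 4 * F (+ (4 ℕ.+ n)) ≤_) (sym (3L[3+n]≡4F[4+n]+F[n] n))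
  (ℤP.i≤i+j _ (F (+ n)) {{ℤ.nonNegative (F-nonNeg n)}})

lucasRatio>√5-2-of-L≥0 : ∀ n j → + 0 ≤ L j → lucasRatio (2 ℕ.+ n) j >√5-2
lucasRatio>√5-2-of-L≥0 n j 0≤Lj =
  >√5-2-mono-≤ (÷ℤ-mono-≤ {+ 4} {+ 15} (+<+ (s≤s z≤n)) (5F-pos (2 ℕ.+ n)) cross) 4/15>√5-2
  where
  -- 5 · 15² = 1125 < 1156 = (4 + 2 · 15)²
  4/15>√5-2 : ((+ 4) ÷ℤ (+ 15)) >√5-2
  4/15>√5-2 = ÷ℤ->√5-2 (+ 4) (+ 15) (+<+ (s≤s z≤n)) (+<+ (s≤s z≤n)) (+<+ (ℕP.m≤m+n 1126 30))
  Lₙ = L (+ (2 ℕ.+ n))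
  cross : + 4 * (+ 5 * F (+ (3 ℕ.+ n))) ≤ (Lₙ + L j) * + 15
  cross = begin
    + 4 * (+ 5 * F (+ (3 ℕ.+ n))) ≡⟨ reassoc (F (+ (3 ℕ.+ n))) ⟩
    + 5 * (+ 4 * F (+ (3 ℕ.+ n))) ≤⟨ ℤP.*-monoˡ-≤-nonNeg (+ 5) (4F[3+n]≤3L[2+n] n) ⟩
    + 5 * (+ 3 * Lₙ)             ≡⟨ reassoc′ Lₙ ⟩
    Lₙ * + 15                    ≤⟨ ℤP.*-monoʳ-≤-nonNeg (+ 15) (ℤP.i≤i+j Lₙ (L j) {{ℤ.nonNegative 0≤Lj}}) ⟩
    (Lₙ + L j) * + 15             ∎
    where
    open ℤP.≤-Reasoning
    reassoc : ∀ x → + 4 * (+ 5 * x) ≡ + 5 * (+ 4 * x)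
    reassoc = solve-∀
    reassoc′ : ∀ x → + 5 * (+ 3 * x) ≡ x * + 15
    reassoc′ = solve-∀

lucasRatio>√5-2-of-oddNeg : ∀ {s t} → s ℕ.≤ t → lucasRatio (5 ℕ.+ (t ℕ.+ t)) -[1+ s ℕ.+ s ] >√5-2
lucasRatio>√5-2-of-oddNeg {s} {t} s≤t =
  >√5-2-mono-≤ (÷ℤ-mono-≤ {X} {B} (F-pos (5 ℕ.+ N)) (5F-pos (5 ℕ.+ N)) cross) X/B>√5-2
  where
  N = t ℕ.+ t
  X = F (+ (3 ℕ.+ N))
  Z = F (+ (4 ℕ.+ N))
  B = F (+ (6 ℕ.+ N))
  A = L (+ (5 ℕ.+ N)) + L -[1+ s ℕ.+ s ]
  instance _ = ℤ.nonNegative (F-nonNeg (6 ℕ.+ N))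

  cassini-odd : Z * Z - X * (X + Z) ≡ -1ℤ
  cassini-odd = trans (cassini (3 ℕ.+ N)) (cong (λ x → -1ℤ * (-1ℤ * (-1ℤ * x))) (-1^[n+n]≡1 t))

  expand : ∀ x z → let b = z + (x + z) in
           (x + + 2 * b) * (x + + 2 * b) ≡ + 5 * (b * b) - + 4 * (z * z - x * (x + z))
  expand = solve-∀

  [X+2B]²≡5B²+4 : (X + + 2 * B) * (X + + 2 * B) ≡ + 5 * (B * B) + + 4
  [X+2B]²≡5B²+4 = trans (expand X Z) (cong (λ c → + 5 * (B * B) - + 4 * c) cassini-odd)

  X/B>√5-2 : (X ÷ℤ B) >√5-2
  X/B>√5-2 = ÷ℤ->√5-2 X B (F-pos (5 ℕ.+ N))
    (ℤP.+-mono-≤-< (F-nonNeg (3 ℕ.+ N)) (ℤP.*-monoˡ-<-pos (+ 2) (F-pos (5 ℕ.+ N))))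
    (subst (+ 5 * (B * B) <_) (sym [X+2B]²≡5B²+4)
      (subst (_< + 5 * (B * B) + + 4) (ℤP.+-identityʳ _) (ℤP.+-monoʳ-< (+ 5 * (B * B)) (+<+ (s≤s z≤n)))))

  5X≤A : + 5 * X ≤ A
  5X≤A = begin
    + 5 * X                              ≤⟨ ℤP.i≤i+j (+ 5 * X) (L (+ suc N) - L (+ suc (s ℕ.+ s)))
                                              {{ℤ.nonNegative (ℤP.i≤j⇒0≤j-i (L-mono (ℕP.+-mono-≤ s≤t s≤t)))}} ⟩
    + 5 * X + (L (+ suc N) - L (+ suc (s ℕ.+ s))) ≡⟨ regroup (+ 5 * X) (L (+ suc N)) (L (+ suc (s ℕ.+ s))) ⟩
    (L (+ suc N) + + 5 * X) - L (+ suc (s ℕ.+ s)) ≡⟨ cong₂ _+_ (L[4+n]≡L[n]+5F[2+n] (suc N)) (L[-1-s-s]≡-L[1+s+s] s) ⟨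
    A                                    ∎
    where
    open ℤP.≤-Reasoning
    regroup : ∀ x y z → x + (y - z) ≡ (y + x) - z
    regroup = solve-∀

  cross : X * (+ 5 * B) ≤ A * B
  cross = begin
    X * (+ 5 * B) ≡⟨ reassoc X B ⟩
    (+ 5 * X) * B ≤⟨ ℤP.*-monoʳ-≤-nonNeg B 5X≤A ⟩
    A * B         ∎
    where
    open ℤP.≤-Reasoning
    reassoc : ∀ x b → x * (+ 5 * b) ≡ (+ 5 * x) * b
    reassoc = solve-∀

data Parity : ℕ → Set where
  even : ∀ u → Parity (u ℕ.+ u)
  odd  : ∀ u → Parity (suc (u ℕ.+ u))

parity : ∀ n → Parity n
parity zero    = even 0
parity (suc n) with parity n
... | even u = odd u
... | odd u  = subst Parity (cong suc (ℕP.+-suc u u)) (even (suc u))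

lucasRatio>√5-2-of-odd : ∀ q u →
  let p = (q ℕ.+ q) ℕ.+ suc (u ℕ.+ u) in lucasRatio (2 ℕ.+ p) (+ (4 ℕ.+ p) - + 4 * + suc q) >√5-2
lucasRatio>√5-2-of-odd q u with q ℕP.≤? u
... | yes q≤u with ℕP.m≤n⇒∃[o]m+o≡n q≤u
...   | a , refl = subst (λ j → lucasRatio (2 ℕ.+ p) j >√5-2) (sym (j≡ (+ q) (+ a)))
                   (lucasRatio>√5-2-of-L≥0 p (+ suc (a ℕ.+ a)) (L-nonNeg (suc (a ℕ.+ a))))
  where
  p = (q ℕ.+ q) ℕ.+ suc ((q ℕ.+ a) ℕ.+ (q ℕ.+ a))
  j≡ : ∀ Q A → (+ 4 + ((Q + Q) + (+ 1 + ((Q + A) + (Q + A))))) - + 4 * (+ 1 + Q) ≡ + 1 + (A + A)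
  j≡ = solve-∀
lucasRatio>√5-2-of-odd q u | no q≰u with ℕP.m≤n⇒∃[o]m+o≡n (ℕP.≰⇒> q≰u)
... | s , refl = subst₂ (λ n j → lucasRatio n j >√5-2) (sym (n≡ u s)) (sym (j≡ (+ u) (+ s)))
                   (lucasRatio>√5-2-of-oddNeg (ℕP.m≤n+m s (u ℕ.+ u)))
  where
  n≡ : ∀ u s → 2 ℕ.+ ((suc (u ℕ.+ s) ℕ.+ suc (u ℕ.+ s)) ℕ.+ suc (u ℕ.+ u))
               ≡ 5 ℕ.+ ((u ℕ.+ u ℕ.+ s) ℕ.+ (u ℕ.+ u ℕ.+ s))
  n≡ = ℕ-solve-∀
  j≡ : ∀ U S → (+ 4 + (((+ 1 + U + S) + (+ 1 + U + S)) + (+ 1 + (U + U)))) - + 4 * (+ 1 + (+ 1 + U + S))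
               ≡ - (+ 1 + (S + S))
  j≡ = solve-∀

lucasRatio>√5-2 : ∀ p q → q ℕ.+ q ℕ.≤ p → lucasRatio (2 ℕ.+ p) (+ (4 ℕ.+ p) - + 4 * + suc q) >√5-2
lucasRatio>√5-2 p q 2q≤p with ℕP.m≤n⇒∃[o]m+o≡n 2q≤p
... | h , refl with parity h
... | even u = subst (λ j → lucasRatio (2 ℕ.+ p) j >√5-2) (sym (j≡ (+ q) (+ u)))
                (lucasRatio>√5-2-of-L≥0 p ((+ u - + q) + (+ u - + q)) (L[i+i]≥0 (+ u - + q)))
  where
  j≡ : ∀ Q U → (+ 4 + ((Q + Q) + (U + U))) - + 4 * (+ 1 + Q) ≡ (U - Q) + (U - Q)
  j≡ = solve-∀
... | odd u = lucasRatio>√5-2-of-odd q u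

8F[3+n]≤21F[1+n] : ∀ n → n ≢ 1 → n ≢ 3 → + 8 * F (+ (3 ℕ.+ n)) ≤ + 21 * F (+ (1 ℕ.+ n))
8F[3+n]≤21F[1+n] 0 _ _ = +≤+ (ℕP.m≤m+n 16 5)
8F[3+n]≤21F[1+n] 1 n≢1 _ = contradiction refl n≢1
8F[3+n]≤21F[1+n] 2 _ _ = +≤+ (ℕP.m≤m+n 40 2)
8F[3+n]≤21F[1+n] 3 _ n≢3 = contradiction refl n≢3
8F[3+n]≤21F[1+n] 4 _ _ = +≤+ (ℕP.m≤m+n 104 1)
8F[3+n]≤21F[1+n] (suc (suc (suc (suc (suc n))))) _ _ =
  subst (+ 8 * F (+ (8 ℕ.+ n)) ≤_) (sym (21F[6+n]≡8F[8+n]+F[n] n))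
    (ℤP.i≤i+j _ (F (+ n)) {{ℤ.nonNegative (F-nonNeg n)}})

lucasRatio≥8/21 : ∀ n → n ≢ 1 → n ≢ 3 → (+ 8 ℚ./ 21) ℚ.≤ lucasRatio (2 ℕ.+ n) (+ n)
lucasRatio≥8/21 n n≢1 n≢3 = ÷ℤ-mono-≤ {+ 8} {+ 21} (+<+ (s≤s z≤n)) (5F-pos (2 ℕ.+ n)) (begin
  + 8 * (+ 5 * F (+ (3 ℕ.+ n)))       ≡⟨ reassoc (+ 8) (F (+ (3 ℕ.+ n))) ⟩
  + 5 * (+ 8 * F (+ (3 ℕ.+ n)))       ≤⟨ ℤP.*-monoˡ-≤-nonNeg (+ 5) (8F[3+n]≤21F[1+n] n n≢1 n≢3) ⟩
  + 5 * (+ 21 * F (+ (1 ℕ.+ n)))      ≡⟨ reassoc′ (F (+ (1 ℕ.+ n))) ⟩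
  (+ 5 * F (+ (1 ℕ.+ n))) * + 21      ≡⟨ cong (_* + 21) (L[2+n]+L[n]≡5F[1+n] n) ⟨
  (L (+ (2 ℕ.+ n)) + L (+ n)) * + 21  ∎)
  where
  open ℤP.≤-Reasoning
  reassoc : ∀ k x → k * (+ 5 * x) ≡ + 5 * (k * x)
  reassoc = solve-∀
  reassoc′ : ∀ x → + 5 * (+ 21 * x) ≡ (+ 5 * x) * + 21
  reassoc′ = solve-∀

1+q≤[2+p]/2⇒q+q≤p : ∀ {p q} → suc q ℕ.≤ (2 ℕ.+ p) ℕ./ 2 → q ℕ.+ q ℕ.≤ p
1+q≤[2+p]/2⇒q+q≤p {p} {q} 1+q≤[2+p]/2 =
  subst (ℕ._≤ p) (trans (ℕP.*-comm q 2) (cong (q ℕ.+_) (ℕP.+-identityʳ q)))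
    (ℕ.s≤s⁻¹ (ℕ.s≤s⁻¹ (ℕP.≤-trans (ℕP.*-monoˡ-≤ 2 1+q≤[2+p]/2) (DM.m/n*n≤m (2 ℕ.+ p) 2))))

lemma32 : ((m y : ℤ) → + 4 ≤ m → + 1 ≤ y → y ≤ (m - + 2) /ℕ 2 →
              ((L (m - + 2) + L (m - + 4 * y)) ÷ℤ (+ 5 * F (m - + 1))) >√5-2)
            × ((m : ℤ) → + 4 ≤ m → m ≢ + 5 → m ≢ + 7 →
              (+ 8 ℚ./ 21) ℚ.≤ ((L (m - + 2) + L (m - + 4)) ÷ℤ (+ 5 * F (m - + 1))))
lemma32 =
  (λ { (+ _) (+ _) (+≤+ (s≤s (s≤s (s≤s (s≤s {n = p} _))))) (+≤+ (s≤s {n = q} _)) (+≤+ y≤[m-2]/2) →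
         lucasRatio>√5-2 p q (1+q≤[2+p]/2⇒q+q≤p y≤[m-2]/2) }) ,
  (λ { (+ _) (+≤+ (s≤s (s≤s (s≤s (s≤s {n = p} _))))) m≢5 m≢7 →
         lucasRatio≥8/21 p (m≢5 ∘ cong (λ k → + (4 ℕ.+ k))) (m≢7 ∘ cong (λ k → + (4 ℕ.+ k))) })
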